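{- For every integer $k$ with $1\leq k\leq 4$, $E(6,k)\leq 4$.
   Context: A system $v_1,\ldots,v_k$ of vectors in $\mathbb{R}^n$ is called orthoregular if (i) $v_i\perp v_j$ (standard inner product) for $i\neq j$, and (ii) $|v_i|=|v_j|\neq 0$ for all $i,j$ ($|\cdot|$ the Euclidean norm); the common value is the length of the system. For an orthoregular system $S\subset\mathbb{Z}^n$, $E(S)$ denotes the maximum number of vectors in an orthoregular system of integer vectors in $\mathbb{Z}^n$ containing $S$. For integers $0<k<n$, $E(n,k)$ denotes the minimum of $E(S)$ over all orthoregular systems $S\subset\mathbb{Z}^n$ with $k$ elements (of any length). -}

module Defs where

open import Data.Nat using (ℕ; _≤_)
open import Data.Integer using (ℤ; _+_; _*_; 0ℤ)
open import Data.Fin using (Fin)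
open import Data.Vec using (Vec; foldr; zipWith)
open import Data.Product using (Σ; ∃; _×_)
open import Relation.Binary.PropositionalEquality using (_≡_; _≢_)

dot : ∀ {n} → Vec ℤ n → Vec ℤ n → ℤ
dot u v = foldr _ _+_ 0ℤ (zipWith _*_ u v)

System : ℕ → ℕ → Set
System n k = Fin k → Vec ℤ n

-- orthoregular: pairwise orthogonal, all of equal nonzero length
-- (equal lengths ⇔ equal squared lengths; |v| ≠ 0 ⇔ |v|² ≠ 0)
Orthoregular : ∀ {n k} → System n k → Set
Orthoregular {n} {k} S =
  (∀ i j → i ≢ j → dot (S i) (S j) ≡ 0ℤ) ×
  (∀ i j → dot (S i) (S i) ≡ dot (S j) (S j)) ×
  (∀ i → dot (S i) (S i) ≢ 0ℤ)

Contains : ∀ {n k m} → System n m → System n k → Set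
Contains T S = ∀ i → ∃ λ j → T j ≡ S i

E≤ : ∀ {n k} → System n k → ℕ → Set
E≤ {n} S b = ∀ (m : ℕ) (T : System n m) → Orthoregular T → Contains T S → m ≤ b

-- E(n,k) ≤ b : some orthoregular S ⊂ ℤ^n with k elements has E(S) ≤ b
-- (the minimum over such S is attained since E(S) takes values in {k,…,n})
Enk≤ : ℕ → ℕ → ℕ → Set
Enk≤ n k b = Σ (System n k) λ S → Orthoregular S × E≤ S b

{-# OPTIONS --safe #-}
-- Reduce modulo 2: xy mod 2 depends only on the parities of x and y, and x² ≡ 1 or 0 (mod 4)
-- as x is odd or even. Hence a vector of ℤ⁶ of squared length 3 has exactly three odd
-- coordinates, and the sets of odd coordinates of two orthogonal vectors meet in an even number
-- of places. A finite search shows that no five 3-subsets of a 6-set pairwise meet evenly, so an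
-- orthogonal system of squared length 3 in ℤ⁶ has at most four vectors. Every orthoregular system
-- containing a subsystem S of the four orthogonal vectors of squared length 3 below has squared
-- length 3 as well, so E(S) ≤ 4.
module Submission where

open import Defs
open import Data.Bool using (Bool; true; false; _∧_)
open import Data.Empty using (⊥; ⊥-elim)
open import Data.Fin as Fin using (Fin; zero; suc; inject≤)
open import Data.Fin.Properties using (all?; inject≤-injective; <⇒≢)
open import Data.Fin.Subset using (Subset; _∩_; ∣_∣; inside; outside)
open import Data.Fin.Subset.Properties using (∣p∣≤n)
open import Data.Integer as ℤ using (ℤ; +_; _+_; _*_; _-_; -_; 0ℤ)
open import Data.Integer.DivMod using (_%_; _/_; a≡a%n+[a/n]*n; n%d<d)
import Data.Integer.Divisibility as ℤ
import Data.Integer.Properties as ℤ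
open import Data.Integer.Tactic.RingSolver using (solve-∀)
open import Data.List using (List; [_]; _++_; map; filter)
open import Data.List.Relation.Unary.Any using (here)
open import Data.List.Membership.Propositional using (_∈_)
open import Data.List.Membership.Propositional.Properties using (∈-++⁺ˡ; ∈-++⁺ʳ; ∈-map⁺; ∈-filter⁺)
open import Data.List.Relation.Unary.All as All using (All)
open import Data.Nat as ℕ using (ℕ; _≤_; s≤s; z≤n; _≡ᵇ_)
open import Data.Nat.Divisibility using (_∣_; _∣?_; divides)
import Data.Nat.Properties as ℕ
open import Data.Product using (∃; _,_)
open import Data.Vec as Vec using (Vec; []; _∷_)
open import Function using (_∘_; id)
open import Function.Definitions using (Injective)
open import Relation.Binary using (Decidable)
open import Relation.Binary.PropositionalEquality using (_≡_; _≢_; refl; sym; trans; cong; cong₂; subst; module ≡-Reasoning)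
open import Relation.Nullary using (Dec; yes; no; ¬_; contradiction)
open import Relation.Nullary.Decidable using (_×-dec_; _→-dec_; ¬?; toWitness; from-no)

module Cliques {A : Set} {R : A → A → Set} (R? : Decidable R) where

  IsClique : ∀ {k} → (Fin k → A) → Set
  IsClique x = ∀ {i j} → i Fin.< j → R (x i) (x j)

  CliqueFree : ℕ → List A → Set
  CliqueFree ℕ.zero    cs = ⊥
  CliqueFree (ℕ.suc k) cs = All (λ a → CliqueFree k (filter (R? a) cs)) cs

  cliqueFree? : ∀ k cs → Dec (CliqueFree k cs)
  cliqueFree? ℕ.zero    cs = no id
  cliqueFree? (ℕ.suc k) cs = All.all? (λ a → cliqueFree? k (filter (R? a) cs)) cs

  cliqueFree⇒¬clique : ∀ {k cs} → CliqueFree k cs →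
                       (x : Fin k → A) → (∀ i → x i ∈ cs) → ¬ IsClique x
  cliqueFree⇒¬clique {ℕ.suc k} free x x∈cs clique =
    cliqueFree⇒¬clique (All.lookup free (x∈cs zero)) (x ∘ suc)
      (λ i → ∈-filter⁺ (R? (x zero)) (x∈cs (suc i)) (clique (s≤s z≤n)))
      (λ i<j → clique (s≤s i<j))

allSubsets : ∀ n → List (Subset n)
allSubsets ℕ.zero    = [ [] ]
allSubsets (ℕ.suc n) = map (inside ∷_) (allSubsets n) ++ map (outside ∷_) (allSubsets n)

∈-allSubsets : ∀ {n} (p : Subset n) → p ∈ allSubsets n
∈-allSubsets []            = here refl
∈-allSubsets (inside  ∷ p) = ∈-++⁺ˡ (∈-map⁺ (inside ∷_) (∈-allSubsets p))
∈-allSubsets (outside ∷ p) = ∈-++⁺ʳ _ (∈-map⁺ (outside ∷_) (∈-allSubsets p))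

MeetEvenly : ∀ {n} → Subset n → Subset n → Set
MeetEvenly p q = 2 ∣ ∣ p ∩ q ∣

meetEvenly? : ∀ {n} → Decidable (MeetEvenly {n})
meetEvenly? p q = 2 ∣? ∣ p ∩ q ∣

triples : List (Subset 6)
triples = filter (λ p → ∣ p ∣ ℕ.≟ 3) (allSubsets 6)

open Cliques (meetEvenly? {6}) using (IsClique; CliqueFree; cliqueFree?; cliqueFree⇒¬clique)

triples-cliqueFree : CliqueFree 5 triples
triples-cliqueFree = toWitness {a? = cliqueFree? 5 triples} _

infix 4 _≡_[mod_]
_≡_[mod_] : ℤ → ℕ → ℕ → Set
x ≡ c [mod m ] = ∃ λ q → x ≡ + c + + m * q

+-mod : ∀ {m x y a b} → x ≡ a [mod m ] → y ≡ b [mod m ] → x + y ≡ a ℕ.+ b [mod m ]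
+-mod {m} {a = a} {b} (q , refl) (r , refl) = q + r , (begin
  (+ a + + m * q) + (+ b + + m * r) ≡⟨ regroup (+ a) (+ b) (+ m) q r ⟩
  (+ a + + b) + + m * (q + r)       ≡⟨ cong (_+ + m * (q + r)) (ℤ.pos-+ a b) ⟨
  + (a ℕ.+ b) + + m * (q + r)       ∎)
  where
  open ≡-Reasoning
  regroup : ∀ a b m q r → (a + m * q) + (b + m * r) ≡ (a + b) + m * (q + r)
  regroup = solve-∀

mod⇒∣ : ∀ {m x c} → x ≡ c [mod m ] → + m ℤ.∣ x - + c
mod⇒∣ {m} {c = c} (q , refl) = divides ℤ.∣ q ∣ (begin
  ℤ.∣ (+ c + + m * q) - + c ∣ ≡⟨ cong ℤ.∣_∣ (cancel (+ c) (+ m) q) ⟩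
  ℤ.∣ + m * q ∣               ≡⟨ ℤ.abs-* (+ m) q ⟩
  m ℕ.* ℤ.∣ q ∣               ≡⟨ ℕ.*-comm m ℤ.∣ q ∣ ⟩
  ℤ.∣ q ∣ ℕ.* m               ∎)
  where
  open ≡-Reasoning
  cancel : ∀ c m q → (c + m * q) - c ≡ m * q
  cancel = solve-∀

indicator : Bool → ℕ
indicator false = 0
indicator true  = 1

isOdd : ℤ → Bool
isOdd x = x % + 2 ≡ᵇ 1

oddCoordinates : ∀ {n} → Vec ℤ n → Subset n
oddCoordinates = Vec.map isOdd

odd-decomposition : ∀ x → x ≡ + indicator (isOdd x) + (x / + 2) * + 2
odd-decomposition x with x % + 2 | n%d<d x (+ 2) | a≡a%n+[a/n]*n x (+ 2)
... | 0 | _ | eq = eq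
... | 1 | _ | eq = eq
... | ℕ.suc (ℕ.suc _) | s≤s (s≤s ()) | _

indicator-∧ : ∀ a b → indicator (a ∧ b) ≡ indicator a ℕ.* indicator b
indicator-∧ false b = refl
indicator-∧ true  b = sym (ℕ.+-identityʳ (indicator b))

*-mod2 : ∀ x y → x * y ≡ indicator (isOdd x ∧ isOdd y) [mod 2 ]
*-mod2 x y = r , (begin
  x * y                                      ≡⟨ cong₂ _*_ (odd-decomposition x) (odd-decomposition y) ⟩
  (a + p * + 2) * (b + q * + 2)              ≡⟨ expand a b p q ⟩
  a * b + + 2 * r                            ≡⟨ cong (_+ + 2 * r) (ℤ.pos-* (indicator (isOdd x)) (indicator (isOdd y))) ⟨
  + (indicator (isOdd x) ℕ.* indicator (isOdd y)) + + 2 * r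
                                             ≡⟨ cong (λ n → + n + + 2 * r) (indicator-∧ (isOdd x) (isOdd y)) ⟨
  + indicator (isOdd x ∧ isOdd y) + + 2 * r  ∎)
  where
  open ≡-Reasoning
  a b p q r : ℤ
  a = + indicator (isOdd x)
  b = + indicator (isOdd y)
  p = x / + 2
  q = y / + 2
  r = a * q + p * b + + 2 * p * q
  expand : ∀ a b p q → (a + p * + 2) * (b + q * + 2) ≡ a * b + + 2 * (a * q + p * b + + 2 * p * q)
  expand = solve-∀

indicator² : ∀ b → indicator b ℕ.* indicator b ≡ indicator b
indicator² false = refl
indicator² true  = refl

square-mod4 : ∀ x → x * x ≡ indicator (isOdd x) [mod 4 ]
square-mod4 x = r , (begin
  x * x                          ≡⟨ cong₂ _*_ (odd-decomposition x) (odd-decomposition x) ⟩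
  (a + p * + 2) * (a + p * + 2)  ≡⟨ expand a p ⟩
  a * a + + 4 * r                ≡⟨ cong (_+ + 4 * r) (ℤ.pos-* (indicator (isOdd x)) (indicator (isOdd x))) ⟨
  + (indicator (isOdd x) ℕ.* indicator (isOdd x)) + + 4 * r
                                 ≡⟨ cong (λ n → + n + + 4 * r) (indicator² (isOdd x)) ⟩
  a + + 4 * r                    ∎)
  where
  open ≡-Reasoning
  a p r : ℤ
  a = + indicator (isOdd x)
  p = x / + 2
  r = a * p + p * p
  expand : ∀ a p → (a + p * + 2) * (a + p * + 2) ≡ a * a + + 4 * (a * p + p * p)
  expand = solve-∀

∣x∷p∣≡indicator+∣p∣ : ∀ {n} x (p : Subset n) → ∣ x ∷ p ∣ ≡ indicator x ℕ.+ ∣ p ∣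
∣x∷p∣≡indicator+∣p∣ false p = refl
∣x∷p∣≡indicator+∣p∣ true  p = refl

dot-mod2 : ∀ {n} (u v : Vec ℤ n) → dot u v ≡ ∣ oddCoordinates u ∩ oddCoordinates v ∣ [mod 2 ]
dot-mod2 []      []      = 0ℤ , refl
dot-mod2 (x ∷ u) (y ∷ v) =
  subst (x * y + dot u v ≡_[mod 2 ])
        (sym (∣x∷p∣≡indicator+∣p∣ (isOdd x ∧ isOdd y) (oddCoordinates u ∩ oddCoordinates v)))
        (+-mod {m = 2} (*-mod2 x y) (dot-mod2 u v))

dot-self-mod4 : ∀ {n} (u : Vec ℤ n) → dot u u ≡ ∣ oddCoordinates u ∣ [mod 4 ]
dot-self-mod4 []      = 0ℤ , refl
dot-self-mod4 (x ∷ u) =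
  subst (x * x + dot u u ≡_[mod 4 ])
        (sym (∣x∷p∣≡indicator+∣p∣ (isOdd x) (oddCoordinates u)))
        (+-mod {m = 4} (square-mod4 x) (dot-self-mod4 u))

orthogonal⇒meetEvenly : ∀ {n} (u v : Vec ℤ n) → dot u v ≡ 0ℤ →
                        MeetEvenly (oddCoordinates u) (oddCoordinates v)
orthogonal⇒meetEvenly u v u⊥v =
  subst (2 ∣_) ∣0-c∣≡c (subst (λ z → + 2 ℤ.∣ z - + c) u⊥v (mod⇒∣ (dot-mod2 u v)))
  where
  c : ℕ
  c = ∣ oddCoordinates u ∩ oddCoordinates v ∣
  ∣0-c∣≡c : ℤ.∣ 0ℤ - + c ∣ ≡ c
  ∣0-c∣≡c = trans (cong ℤ.∣_∣ (ℤ.+-identityˡ (- + c))) (ℤ.∣-i∣≡∣i∣ (+ c))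

4∣3-w⇒w≡3 : ∀ {w} → w ≤ 6 → + 4 ℤ.∣ + 3 - + w → w ≡ 3
4∣3-w⇒w≡3 {0} _ 4∣ = contradiction 4∣ (from-no (4 ∣? 3))
4∣3-w⇒w≡3 {1} _ 4∣ = contradiction 4∣ (from-no (4 ∣? 2))
4∣3-w⇒w≡3 {2} _ 4∣ = contradiction 4∣ (from-no (4 ∣? 1))
4∣3-w⇒w≡3 {3} _ _  = refl
4∣3-w⇒w≡3 {4} _ 4∣ = contradiction 4∣ (from-no (4 ∣? 1))
4∣3-w⇒w≡3 {5} _ 4∣ = contradiction 4∣ (from-no (4 ∣? 2))
4∣3-w⇒w≡3 {6} _ 4∣ = contradiction 4∣ (from-no (4 ∣? 3))
4∣3-w⇒w≡3 {ℕ.suc (ℕ.suc (ℕ.suc (ℕ.suc (ℕ.suc (ℕ.suc (ℕ.suc _))))))} (s≤s (s≤s (s≤s (s≤s (s≤s (s≤s ())))))) _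

squaredLength3⇒oddWeight3 : (u : Vec ℤ 6) → dot u u ≡ + 3 → ∣ oddCoordinates u ∣ ≡ 3
squaredLength3⇒oddWeight3 u ∣u∣²≡3 =
  4∣3-w⇒w≡3 (∣p∣≤n (oddCoordinates u))
    (subst (λ z → + 4 ℤ.∣ z - + ∣ oddCoordinates u ∣) ∣u∣²≡3 (mod⇒∣ (dot-self-mod4 u)))

Orthogonal : ∀ {n k} → System n k → Set
Orthogonal S = ∀ i j → i ≢ j → dot (S i) (S j) ≡ 0ℤ

orthogonal-∘ : ∀ {n k l} {S : System n l} {f : Fin k → Fin l} →
               Injective _≡_ _≡_ f → Orthogonal S → Orthogonal (S ∘ f)
orthogonal-∘ f-injective S⊥ i j i≢j = S⊥ _ _ (i≢j ∘ f-injective)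

oddCoordinates-clique : ∀ {k} (T : System 6 k) → Orthogonal T → IsClique (oddCoordinates ∘ T)
oddCoordinates-clique T T⊥ {i} {j} i<j = orthogonal⇒meetEvenly (T i) (T j) (T⊥ i j (<⇒≢ i<j))

oddCoordinates∈triples : ∀ u → dot u u ≡ + 3 → oddCoordinates u ∈ triples
oddCoordinates∈triples u ∣u∣²≡3 =
  ∈-filter⁺ (λ p → ∣ p ∣ ℕ.≟ 3) (∈-allSubsets (oddCoordinates u)) (squaredLength3⇒oddWeight3 u ∣u∣²≡3)

orthogonal-squaredLength3⇒≤4 : ∀ {m} (T : System 6 m) → Orthogonal T →
                               (∀ i → dot (T i) (T i) ≡ + 3) → m ≤ 4
orthogonal-squaredLength3⇒≤4 {m} T T⊥ ∣T∣²≡3 with m ℕ.≤? 4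
... | yes m≤4 = m≤4
... | no  m≰4 = ⊥-elim (cliqueFree⇒¬clique triples-cliqueFree (oddCoordinates ∘ T₅)
                          (λ i → oddCoordinates∈triples (T₅ i) (∣T∣²≡3 (ι i)))
                          (oddCoordinates-clique T₅ T₅⊥))
  where
  5≤m : 5 ≤ m
  5≤m = ℕ.≰⇒> m≰4
  ι : Fin 5 → Fin m
  ι i = inject≤ i 5≤m
  T₅ : System 6 5
  T₅ = T ∘ ι
  T₅⊥ : Orthogonal T₅
  T₅⊥ = orthogonal-∘ {S = T} (inject≤-injective 5≤m 5≤m _ _) T⊥

orthoregular-∘ : ∀ {n k l} {S : System n l} {f : Fin k → Fin l} →
                 Injective _≡_ _≡_ f → Orthoregular S → Orthoregular (S ∘ f)
orthoregular-∘ {S = S} {f} f-injective (S⊥ , equalLengths , nonzero) =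
  orthogonal-∘ {S = S} f-injective S⊥ , (λ i j → equalLengths (f i) (f j)) , nonzero ∘ f

orthoregular? : ∀ {n k} (S : System n k) → Dec (Orthoregular S)
orthoregular? S =
  all? (λ i → all? λ j → ¬? (i Fin.≟ j) →-dec dot (S i) (S j) ℤ.≟ 0ℤ) ×-dec
  all? (λ i → all? λ j → dot (S i) (S i) ℤ.≟ dot (S j) (S j)) ×-dec
  all? (λ i → ¬? (dot (S i) (S i) ℤ.≟ 0ℤ))

contains⇒sameLength : ∀ {n k m} {S : System n k} {T : System n m} → Orthoregular T → Contains T S →
                      ∀ i j → dot (T j) (T j) ≡ dot (S i) (S i)
contains⇒sameLength (_ , equalLengths , _) T⊇S i j with T⊇S i
... | j′ , Tj′≡Si = trans (equalLengths j j′) (cong (λ v → dot v v) Tj′≡Si)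

fourVectors : System 6 4
fourVectors zero                   = + 1 ∷ + 1 ∷ + 1 ∷ + 0 ∷ + 0 ∷ + 0 ∷ []
fourVectors (suc zero)             = - + 1 ∷ + 0 ∷ + 1 ∷ - + 1 ∷ + 0 ∷ + 0 ∷ []
fourVectors (suc (suc zero))       = - + 1 ∷ + 1 ∷ + 0 ∷ + 1 ∷ + 0 ∷ + 0 ∷ []
fourVectors (suc (suc (suc zero))) = + 0 ∷ - + 1 ∷ + 1 ∷ + 1 ∷ + 0 ∷ + 0 ∷ []

fourVectors-orthoregular : Orthoregular fourVectors
fourVectors-orthoregular = toWitness {a? = orthoregular? fourVectors} _

mainTheorem8 : ∀ (k : ℕ) → 1 ≤ k → k ≤ 4 → Enk≤ 6 k 4
mainTheorem8 (ℕ.suc k) _ 1+k≤4 =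
  S , orthoregular-∘ {S = fourVectors} ι-injective fourVectors-orthoregular , E[S]≤4
  where
  ι : Fin (ℕ.suc k) → Fin 4
  ι i = inject≤ i 1+k≤4
  ι-injective : Injective _≡_ _≡_ ι
  ι-injective = inject≤-injective 1+k≤4 1+k≤4 _ _
  S : System 6 (ℕ.suc k)
  S = fourVectors ∘ ι
  E[S]≤4 : E≤ S 4
  E[S]≤4 m T T-orthoregular@(T⊥ , _) T⊇S =
    orthogonal-squaredLength3⇒≤4 T T⊥ (contains⇒sameLength T-orthoregular T⊇S zero)
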